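{- Let $(b_n)$ be the lens sequence generated by an integer symbol ${}^{s}(p,q)^{k}$, with underground sequence $(f_n)$. If some term of $(f_n)$ equals $\pm1$, then $(b_n)$ (up to a shift of index) admits a label $(a,b;k')$ for some integers $a,b,k'$. More precisely: the lens sequence with label $(a,b;k)$ is the lens sequence generated by the symbol ${}^{a+b}(1,b)^{k}$, and the lens sequence generated by the symbol ${}^{s}(1,b)^{k}$ is the lens sequence with label $(s-b,b;k)$.
   Context: The symbol ${}^{s}(p,q)^{k}$ (integers) defines the underground sequence $(f_n)_{n\in\mathbb Z}$ with $f_0=p$, $f_1=q$, $f_n=kf_{n-1}-f_{n-2}$ for $n$ even and $f_n=sf_{n-1}-f_{n-2}$ for $n$ odd (forwards and backwards), and the lens sequence $b_n=f_{n-1}f_n$, whose consecutive terms $(b_0,b_1,b_2)$ are $((sp-q)p,\,pq,\,q(kq-p))$. For integers $a,b,k$, the label $(a,b;k)$ denotes the lens sequence extended from the seed $(a,b,c)$ with $c=b(bk-1)$, i.e. the bilateral sequence with consecutive terms $a,b,c$ satisfying $b_n=\alpha b_{n-1}-b_{n-2}+\beta$ with $\alpha=(a+b)k-2$, $\beta=(a+b)-abk$. Two lens sequences are identified if they have the same three consecutive terms at the same positions. -}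

module Defs where

open import Data.Bool using (Bool; true; false; if_then_else_)
open import Data.Nat using (ℕ; zero; suc)
open import Data.Integer using (ℤ; +_; -[1+_]; _+_; _-_; _*_; 1ℤ)
open import Data.Product using (_×_; _,_; proj₁)

evenℕ : ℕ → Bool
evenℕ zero = true
evenℕ (suc n) = notEven n
  where
  notEven : ℕ → Bool
  notEven m = if evenℕ m then false else true

mult : (s k : ℤ) → Bool → ℤ
mult s k b = if b then k else s

-- Underground sequence of the symbol  ^s(p,q)^k :
--   f 0 = p, f 1 = q,
--   f n = k f(n-1) - f(n-2)  (n even),  f n = s f(n-1) - f(n-2)  (n odd),
-- extended forwards and backwards.

-- forward: (f n , f (n+1)) for n ≥ 0 ; f(n+2) has the parity of n
fwdU : (s p q k : ℤ) → ℕ → ℤ × ℤ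
fwdU s p q k zero = p , q
fwdU s p q k (suc n) with fwdU s p q k n
... | x , y = y , (mult s k (evenℕ n) * y - x)

-- backward: (f (-m) , f (-m+1)) for m ≥ 0, using
--   f(-m-1) = c(-m+1) f(-m) - f(-m+1), and -m+1 has the parity of m+1
bwdU : (s p q k : ℤ) → ℕ → ℤ × ℤ
bwdU s p q k zero = p , q
bwdU s p q k (suc m) with bwdU s p q k m
... | x , y = (mult s k (evenℕ (suc m)) * x - y) , x

underground : (s p q k : ℤ) → ℤ → ℤ
underground s p q k (+ n) = proj₁ (fwdU s p q k n)
underground s p q k -[1+ m ] = proj₁ (bwdU s p q k (suc m))

lens : (s p q k : ℤ) → ℤ → ℤ
lens s p q k n = underground s p q k (n - 1ℤ) * underground s p q k n

-- Label (a,b;k): bilateral sequence L with L 0 = a, L 1 = b (and hence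
-- L 2 = α b - a + β = b(bk-1) = c), satisfying
--   L n = α L(n-1) - L(n-2) + β,  α = (a+b)k - 2,  β = (a+b) - abk.

α : (a b k : ℤ) → ℤ
α a b k = (a + b) * k - + 2

β : (a b k : ℤ) → ℤ
β a b k = (a + b) - a * b * k

fwdL : (a b k : ℤ) → ℕ → ℤ × ℤ
fwdL a b k zero = a , b
fwdL a b k (suc n) with fwdL a b k n
... | x , y = y , (α a b k * y - x + β a b k)

bwdL : (a b k : ℤ) → ℕ → ℤ × ℤ
bwdL a b k zero = a , b
bwdL a b k (suc m) with bwdL a b k m
... | x , y = (α a b k * x - y + β a b k) , x

label : (a b k : ℤ) → ℤ → ℤ
label a b k (+ n) = proj₁ (fwdL a b k n)
label a b k -[1+ m ] = proj₁ (bwdL a b k (suc m))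

{-# OPTIONS --safe #-}
module Submission where

-- The underground sequence satisfies f(n+1) + f(n-1) = c(n+1) f(n) with c alternating between
-- k (even indices) and s (odd indices), and the binary quadratic form
--   c(n) f(n-1)² + c(n+1) f(n)² − sk f(n-1) f(n)
-- is the same for every n. Multiplying neighbouring recurrences shows that the lens sequence
-- b(n) = f(n-1) f(n) satisfies b(n+1) + b(n-1) = (sk − 2) b(n) + J with J that invariant, so it
-- is determined by any two consecutive terms. When f(m) = ±1, the label recurrence of
-- (b(m), b(m+1); c(m)) has exactly the coefficients sk − 2 and J, hence the two sequences agree.
-- Taking m = 0 for the symbol ^s(1,b)^k gives the explicit label (s − b, b; k).

open import Defs
open import Data.Bool using (Bool; true; false; not)
open import Data.Bool.Properties using (not-involutive)
open import Data.Nat using (zero) renaming (suc to sucℕ)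
open import Data.Integer using (ℤ; _+_; _-_; _*_; 1ℤ; -1ℤ; +_; -[1+_]; suc; pred)
open import Data.Integer.Properties
  using (suc-pred; pred-suc; +-assoc; +-comm; *-comm; +-identityˡ; +-identityʳ; *-identityˡ; *-identityʳ; +-0-abelianGroup)
open import Algebra.Properties.AbelianGroup +-0-abelianGroup using (x≈z//y; //-rightDividesʳ)
open import Data.Integer.Tactic.RingSolver using (solve-∀)
open import Data.Product using (_×_; _,_; ∃-syntax; proj₁; proj₂)
open import Data.Sum using (_⊎_; inj₁; inj₂)
open import Relation.Binary.PropositionalEquality
open ≡-Reasoning

evenℕ-suc : ∀ n → evenℕ (sucℕ n) ≡ not (evenℕ n)
evenℕ-suc n with evenℕ n
... | true = refl
... | false = refl

evenℕ-suc-suc : ∀ n → evenℕ (sucℕ (sucℕ n)) ≡ evenℕ n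
evenℕ-suc-suc n = trans (evenℕ-suc (sucℕ n)) (trans (cong not (evenℕ-suc n)) (not-involutive (evenℕ n)))

evenℤ : ℤ → Bool
evenℤ (+ n) = evenℕ n
evenℤ -[1+ n ] = evenℕ (sucℕ n)

evenℤ-suc : ∀ i → evenℤ (suc i) ≡ not (evenℤ i)
evenℤ-suc (+ n) = evenℕ-suc n
evenℤ-suc -[1+ zero ] = refl
evenℤ-suc -[1+ sucℕ n ] = begin
  evenℕ (sucℕ n)               ≡⟨ not-involutive (evenℕ (sucℕ n)) ⟨
  not (not (evenℕ (sucℕ n)))   ≡⟨ cong not (evenℕ-suc (sucℕ n)) ⟨
  not (evenℕ (sucℕ (sucℕ n)))  ∎

ℤ-induction : (P : ℤ → Set) → P (+ 0) → (∀ i → P i → P (suc i)) → (∀ i → P (suc i) → P i) → ∀ i → P i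
ℤ-induction P P0 up down (+ zero) = P0
ℤ-induction P P0 up down (+ sucℕ n) = up (+ n) (ℤ-induction P P0 up down (+ n))
ℤ-induction P P0 up down -[1+ zero ] = down -[1+ zero ] P0
ℤ-induction P P0 up down -[1+ sucℕ n ] = down -[1+ sucℕ n ] (ℤ-induction P P0 up down -[1+ n ])

record AffineRecurrence (A B : ℤ) (g : ℤ → ℤ) : Set where
  constructor affineRecurrence
  field step : ∀ n → g (suc n) + g (pred n) ≡ A * g n + B

open AffineRecurrence

affineRecurrence-shift : ∀ {A B g} t → AffineRecurrence A B g → AffineRecurrence A B (λ n → g (n + t))
affineRecurrence-shift {A} {B} {g} t rec = affineRecurrence λ n →
  subst₂ (λ i j → g i + g j ≡ A * g (n + t) + B) (sym (+-assoc 1ℤ n t)) (sym (+-assoc -1ℤ n t)) (step rec (n + t))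

affineRecurrence-step₂ : ∀ {A B g} → AffineRecurrence A B g → ∀ n → g (suc (suc n)) + g n ≡ A * g (suc n) + B
affineRecurrence-step₂ {A} {B} {g} rec n =
  subst (λ j → g (suc (suc n)) + g j ≡ A * g (suc n) + B) (pred-suc n) (step rec (suc n))

affineRecurrence-next : ∀ {A B g} → AffineRecurrence A B g → ∀ n → g (suc (suc n)) ≡ A * g (suc n) + B - g n
affineRecurrence-next {g = g} rec n = x≈z//y (g (suc (suc n))) (g n) _ (affineRecurrence-step₂ rec n)

affineRecurrence-previous : ∀ {A B g} → AffineRecurrence A B g → ∀ n → g n ≡ A * g (suc n) + B - g (suc (suc n))
affineRecurrence-previous {g = g} rec n =
  x≈z//y (g n) (g (suc (suc n))) _ (trans (+-comm (g n) _) (affineRecurrence-step₂ rec n))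

affineRecurrence-unique : ∀ {A B g h} → AffineRecurrence A B g → AffineRecurrence A B h →
  g (+ 0) ≡ h (+ 0) → g (+ 1) ≡ h (+ 1) → ∀ n → g n ≡ h n
affineRecurrence-unique {A} {B} {g} {h} recg rech g0 g1 n = proj₁ (ℤ-induction Agree (g0 , g1) up down n)
  where
  Agree : ℤ → Set
  Agree n = g n ≡ h n × g (suc n) ≡ h (suc n)

  up : ∀ n → Agree n → Agree (suc n)
  up n (eq₀ , eq₁) = eq₁ , (begin
    g (suc (suc n))              ≡⟨ affineRecurrence-next recg n ⟩
    A * g (suc n) + B - g n      ≡⟨ cong₂ (λ u v → A * u + B - v) eq₁ eq₀ ⟩
    A * h (suc n) + B - h n      ≡⟨ affineRecurrence-next rech n ⟨
    h (suc (suc n))              ∎)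

  down : ∀ n → Agree (suc n) → Agree n
  down n (eq₁ , eq₂) = (begin
    g n                                  ≡⟨ affineRecurrence-previous recg n ⟩
    A * g (suc n) + B - g (suc (suc n))  ≡⟨ cong₂ (λ u v → A * u + B - v) eq₁ eq₂ ⟩
    A * h (suc n) + B - h (suc (suc n))  ≡⟨ affineRecurrence-previous rech n ⟨
    h n                                  ∎) , eq₁

label-recurrence : ∀ a b k → AffineRecurrence (α a b k) (β a b k) (label a b k)
label-recurrence a b k = affineRecurrence rec
  where
  A = α a b k
  B = β a b k

  fwdL-suc : ∀ n → fwdL a b k (sucℕ n) ≡ (proj₂ (fwdL a b k n) , A * proj₂ (fwdL a b k n) - proj₁ (fwdL a b k n) + B)
  fwdL-suc n with fwdL a b k n
  ... | x , y = refl

  bwdL-suc : ∀ n → bwdL a b k (sucℕ n) ≡ (A * proj₁ (bwdL a b k n) - proj₂ (bwdL a b k n) + B , proj₁ (bwdL a b k n))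
  bwdL-suc n with bwdL a b k n
  ... | x , y = refl

  new+old : ∀ (A y x B : ℤ) → (A * y - x + B) + x ≡ A * y + B
  new+old = solve-∀

  old+new : ∀ (A y x B : ℤ) → x + (A * y - x + B) ≡ A * y + B
  old+new = solve-∀

  rec : ∀ n → label a b k (suc n) + label a b k (pred n) ≡ A * label a b k n + B
  rec (+ zero) = old+new A a b B
  rec (+ sucℕ n) rewrite fwdL-suc (sucℕ n) | fwdL-suc n =
    new+old A (proj₂ (fwdL a b k n)) (proj₁ (fwdL a b k n)) B
  rec -[1+ zero ] rewrite bwdL-suc 1 = old+new A (A * a - b + B) a B
  rec -[1+ sucℕ n ] rewrite bwdL-suc (sucℕ (sucℕ n)) | bwdL-suc (sucℕ n) =
    old+new A _ (proj₁ (bwdL a b k (sucℕ n))) B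

invariant-step : ∀ c d x y →
  d * (y * y) + c * ((d * y - x) * (d * y - x)) - c * d * (y * (d * y - x)) ≡ c * (x * x) + d * (y * y) - c * d * (x * y)
invariant-step = solve-∀

lens-recurrence-identity : ∀ c d x y →
  y * (d * y - x) + (c * x - y) * x ≡ (c * d - + 2) * (x * y) + (c * (x * x) + d * (y * y) - c * d * (x * y))
lens-recurrence-identity = solve-∀

α-at-unit : ∀ x y c d → y ≡ 1ℤ ⊎ y ≡ -1ℤ → α (x * y) (y * (d * y - x)) c ≡ c * d - + 2
α-at-unit x _ c d (inj₁ refl) = at-one x c d
  where
  at-one : ∀ x c d → (x * 1ℤ + 1ℤ * (d * 1ℤ - x)) * c - + 2 ≡ c * d - + 2
  at-one = solve-∀
α-at-unit x _ c d (inj₂ refl) = at-minus-one x c d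
  where
  at-minus-one : ∀ x c d → (x * -1ℤ + -1ℤ * (d * -1ℤ - x)) * c - + 2 ≡ c * d - + 2
  at-minus-one = solve-∀

β-at-unit : ∀ x y c d → y ≡ 1ℤ ⊎ y ≡ -1ℤ →
  β (x * y) (y * (d * y - x)) c ≡ c * (x * x) + d * (y * y) - c * d * (x * y)
β-at-unit x _ c d (inj₁ refl) = at-one x c d
  where
  at-one : ∀ x c d → x * 1ℤ + 1ℤ * (d * 1ℤ - x) - x * 1ℤ * (1ℤ * (d * 1ℤ - x)) * c
                     ≡ c * (x * x) + d * (1ℤ * 1ℤ) - c * d * (x * 1ℤ)
  at-one = solve-∀
β-at-unit x _ c d (inj₂ refl) = at-minus-one x c d
  where
  at-minus-one : ∀ x c d → x * -1ℤ + -1ℤ * (d * -1ℤ - x) - x * -1ℤ * (-1ℤ * (d * -1ℤ - x)) * c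
                           ≡ c * (x * x) + d * (-1ℤ * -1ℤ) - c * d * (x * -1ℤ)
  at-minus-one = solve-∀

sub-sub : ∀ x y c → y ≡ c * x - (c * x - y)
sub-sub = solve-∀

module Underground (s p q k : ℤ) where

  f : ℤ → ℤ
  f = underground s p q k

  c : ℤ → ℤ
  c i = mult s k (evenℤ i)

  c-suc : ∀ i → c (suc i) ≡ mult s k (not (evenℤ i))
  c-suc i = cong (mult s k) (evenℤ-suc i)

  c-suc-suc : ∀ i → c (suc (suc i)) ≡ c i
  c-suc-suc i = trans (c-suc (suc i)) (cong (mult s k) (trans (cong not (evenℤ-suc i)) (not-involutive (evenℤ i))))

  c*c-suc : ∀ i → c i * c (suc i) ≡ s * k
  c*c-suc i = trans (cong (c i *_) (c-suc i)) (mult*mult-not (evenℤ i))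
    where
    mult*mult-not : ∀ b → mult s k b * mult s k (not b) ≡ s * k
    mult*mult-not true = *-comm k s
    mult*mult-not false = refl

  fwdU-suc : ∀ n → fwdU s p q k (sucℕ n) ≡ (proj₂ (fwdU s p q k n) , mult s k (evenℕ n) * proj₂ (fwdU s p q k n) - proj₁ (fwdU s p q k n))
  fwdU-suc n with fwdU s p q k n
  ... | x , y = refl

  bwdU-suc : ∀ n → bwdU s p q k (sucℕ n) ≡ (mult s k (evenℕ (sucℕ n)) * proj₁ (bwdU s p q k n) - proj₂ (bwdU s p q k n) , proj₁ (bwdU s p q k n))
  bwdU-suc n with bwdU s p q k n
  ... | x , y = refl

  f-suc : ∀ i → f (suc i) ≡ c (suc i) * f i - f (pred i)
  f-suc (+ zero) = sub-sub p q s
  f-suc (+ sucℕ n) rewrite fwdU-suc (sucℕ n) | fwdU-suc n | evenℕ-suc-suc n = refl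
  f-suc -[1+ zero ] rewrite bwdU-suc 1 = sub-sub (proj₁ (bwdU s p q k 1)) p k
  f-suc -[1+ sucℕ n ] rewrite bwdU-suc (sucℕ (sucℕ n)) | bwdU-suc (sucℕ n) | evenℕ-suc-suc (sucℕ n) =
    sub-sub (proj₁ (bwdU s p q k (sucℕ (sucℕ n)))) (proj₁ (bwdU s p q k (sucℕ n))) (mult s k (evenℕ (sucℕ n)))

  f-pred-pred : ∀ i → f (pred (pred i)) ≡ c i * f (pred i) - f i
  f-pred-pred i = begin
    f (pred (pred i))                                          ≡⟨ sub-sub (f (pred i)) (f (pred (pred i))) (c i) ⟩
    c i * f (pred i) - (c i * f (pred i) - f (pred (pred i)))  ≡⟨ cong (c i * f (pred i) -_) f-i ⟨
    c i * f (pred i) - f i                                     ∎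
    where
    f-i : f i ≡ c i * f (pred i) - f (pred (pred i))
    f-i = subst (λ j → f j ≡ c j * f (pred i) - f (pred (pred i))) (suc-pred i) (f-suc (pred i))

  invariant : ℤ → ℤ
  invariant i = c i * (f (pred i) * f (pred i)) + c (suc i) * (f i * f i) - s * k * (f (pred i) * f i)

  invariant-suc : ∀ i → invariant (suc i) ≡ invariant i
  invariant-suc i rewrite pred-suc i | c-suc-suc i | f-suc i | sym (c*c-suc i) =
    invariant-step (c i) (c (suc i)) (f (pred i)) (f i)

  invariant-constant : ∀ i → invariant i ≡ invariant (+ 0)
  invariant-constant = ℤ-induction (λ i → invariant i ≡ invariant (+ 0)) refl
    (λ i eq → trans (invariant-suc i) eq) (λ i eq → trans (sym (invariant-suc i)) eq)

  lens≡ : ∀ i → lens s p q k i ≡ f (pred i) * f i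
  lens≡ i = cong (λ j → f j * f i) (+-comm i -1ℤ)

  lens-suc : ∀ i → lens s p q k (suc i) ≡ f i * (c (suc i) * f i - f (pred i))
  lens-suc i = begin
    lens s p q k (suc i)                  ≡⟨ lens≡ (suc i) ⟩
    f (pred (suc i)) * f (suc i)          ≡⟨ cong₂ (λ j y → f j * y) (pred-suc i) (f-suc i) ⟩
    f i * (c (suc i) * f i - f (pred i))  ∎

  lens-recurrence : AffineRecurrence (s * k - + 2) (invariant (+ 0)) (lens s p q k)
  lens-recurrence = affineRecurrence lens-step
    where
    lens-step : ∀ i → lens s p q k (suc i) + lens s p q k (pred i) ≡ (s * k - + 2) * lens s p q k i + invariant (+ 0)
    lens-step i = begin
      lens s p q k (suc i) + lens s p q k (pred i)       ≡⟨ cong₂ _+_ (lens-suc i) (lens≡ (pred i)) ⟩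
      y * (d * y - x) + f (pred (pred i)) * x           ≡⟨ cong (λ w → y * (d * y - x) + w * x) (f-pred-pred i) ⟩
      y * (d * y - x) + (c i * x - y) * x               ≡⟨ lens-recurrence-identity (c i) d x y ⟩
      (c i * d - + 2) * (x * y) + (c i * (x * x) + d * (y * y) - c i * d * (x * y))
        ≡⟨ cong (λ e → (e - + 2) * (x * y) + (c i * (x * x) + d * (y * y) - e * (x * y))) (c*c-suc i) ⟩
      (s * k - + 2) * (x * y) + invariant i               ≡⟨ cong₂ (λ b J → (s * k - + 2) * b + J) (sym (lens≡ i)) (invariant-constant i) ⟩
      (s * k - + 2) * lens s p q k i + invariant (+ 0)   ∎
      where
      x = f (pred i)
      y = f i
      d = c (suc i)

  lens-shift≡label : ∀ m → f m ≡ 1ℤ ⊎ f m ≡ -1ℤ →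
    ∀ n → lens s p q k (n + m) ≡ label (lens s p q k m) (lens s p q k (suc m)) (c m) n
  lens-shift≡label m unit = affineRecurrence-unique
    (affineRecurrence-shift m lens-recurrence)
    (subst₂ (λ A B → AffineRecurrence A B (label a b (c m))) α≡ β≡ (label-recurrence a b (c m)))
    (cong (lens s p q k) (+-identityˡ m))
    refl
    where
    a = lens s p q k m
    b = lens s p q k (suc m)
    x = f (pred m)
    y = f m
    d = c (suc m)

    α≡ : α a b (c m) ≡ s * k - + 2
    α≡ = begin
      α a b (c m)                        ≡⟨ cong₂ (λ a b → α a b (c m)) (lens≡ m) (lens-suc m) ⟩
      α (x * y) (y * (d * y - x)) (c m)  ≡⟨ α-at-unit x y (c m) d unit ⟩
      c m * d - + 2                      ≡⟨ cong (_- + 2) (c*c-suc m) ⟩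
      s * k - + 2                        ∎

    β≡ : β a b (c m) ≡ invariant (+ 0)
    β≡ = begin
      β a b (c m)                        ≡⟨ cong₂ (λ a b → β a b (c m)) (lens≡ m) (lens-suc m) ⟩
      β (x * y) (y * (d * y - x)) (c m)  ≡⟨ β-at-unit x y (c m) d unit ⟩
      c m * (x * x) + d * (y * y) - c m * d * (x * y)
        ≡⟨ cong (λ e → c m * (x * x) + d * (y * y) - e * (x * y)) (c*c-suc m) ⟩
      invariant m                        ≡⟨ invariant-constant m ⟩
      invariant (+ 0)                    ∎

lens-of-unit-seed≡label : ∀ s b k n → lens s 1ℤ b k n ≡ label (s - b) b k n
lens-of-unit-seed≡label s b k n = begin
  lens s 1ℤ b k n                                   ≡⟨ cong (lens s 1ℤ b k) (+-identityʳ n) ⟨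
  lens s 1ℤ b k (n + + 0)                           ≡⟨ Underground.lens-shift≡label s 1ℤ b k (+ 0) (inj₁ refl) n ⟩
  label ((s * 1ℤ - b) * 1ℤ) (1ℤ * b) k n
    ≡⟨ cong₂ (λ a b′ → label a b′ k n) (trans (*-identityʳ _) (cong (_- b) (*-identityʳ s))) (*-identityˡ b) ⟩
  label (s - b) b k n                               ∎

label≡lens : ∀ a b k n → label a b k n ≡ lens (a + b) 1ℤ b k n
label≡lens a b k n = begin
  label a b k n                 ≡⟨ cong (λ a′ → label a′ b k n) (//-rightDividesʳ b a) ⟨
  label (a + b - b) b k n       ≡⟨ lens-of-unit-seed≡label (a + b) b k n ⟨
  lens (a + b) 1ℤ b k n         ∎

corollary5p10 : ((s p q k : ℤ) →
    (∃[ m ] (underground s p q k m ≡ 1ℤ ⊎ underground s p q k m ≡ -1ℤ)) →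
    ∃[ t ] ∃[ a ] ∃[ b ] ∃[ k′ ] ((n : ℤ) → lens s p q k (n + t) ≡ label a b k′ n))
    × ((a b k : ℤ) → (n : ℤ) → label a b k n ≡ lens (a + b) 1ℤ b k n)
    × ((s b k : ℤ) → (n : ℤ) → lens s 1ℤ b k n ≡ label (s - b) b k n)
corollary5p10 =
  (λ s p q k → λ { (m , unit) → m , _ , _ , _ , Underground.lens-shift≡label s p q k m unit })
  , label≡lens
  , lens-of-unit-seed≡label
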